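{- $\kappa^0(C_6^2) \ge 3/7$.
   Context: An oriented graph is a loopless directed graph with at most one of $uv$, $vu$ for each pair of distinct vertices. $\delta^0(G)$ is the minimum semi-degree (minimum of all in- and out-degrees). For an oriented graph $H$ and $n \in \mathbb{N}$, $g(n,H)$ is the smallest number such that every oriented graph $G$ on $n$ vertices with $\delta^0(G) \ge g(n,H)$ contains a copy of $H$, and $\kappa^0(H) = \lim_{n\to\infty} g(n,H)/n$ (this limit exists). $C_k^\ell$ denotes the $\ell$-th power of the consistently oriented cycle on $k$ vertices, i.e. vertices $v_1,\dots,v_k$ with an edge $v_iv_j$ whenever $j - i \in \{1,\dots,\ell\}$ modulo $k$; so $C_6^2$ has vertices $v_1,\dots,v_6$ and edges $v_iv_{i+1}$, $v_iv_{i+2}$ (indices mod 6). -}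

module Defs where

open import Data.Nat using (ℕ; zero; suc; _+_; _*_; _∸_; _≤_; _<_; NonZero)
open import Data.Nat.DivMod using (_%_)
open import Data.Fin using (Fin; toℕ)
open import Data.Bool using (Bool; true; false; _∧_)
open import Data.List using (List; length; filter)
open import Data.List.Base using (allFin)
open import Data.Product using (Σ; _×_)
open import Relation.Binary.PropositionalEquality using (_≡_)
open import Relation.Nullary using (¬_)
open import Data.Bool.Properties using (T?)
open import Function.Definitions using (Injective)
open import Data.Bool using (T)

record OrientedGraph (n : ℕ) : Set where
  field
    adj       : Fin n → Fin n → Bool
    loopless  : ∀ v → adj v v ≡ false
    oriented  : ∀ u v → adj u v ≡ true → adj v u ≡ false
open OrientedGraph public

outdeg : ∀ {n} → OrientedGraph n → Fin n → ℕ
outdeg {n} G v = length (filter (λ w → T? (adj G v w)) (allFin n))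

indeg : ∀ {n} → OrientedGraph n → Fin n → ℕ
indeg {n} G v = length (filter (λ w → T? (adj G w v)) (allFin n))

MinSemiDegAtLeast : ∀ {n} → OrientedGraph n → ℕ → Set
MinSemiDegAtLeast {n} G d = ∀ (v : Fin n) → (d ≤ outdeg G v) × (d ≤ indeg G v)

-- ℓ-th power of the consistently oriented cycle on k vertices:
-- edge v_i v_j iff (j - i) mod k ∈ {1,…,ℓ}
cycPowAdj : (k ℓ : ℕ) .{{_ : NonZero k}} → Fin k → Fin k → Set
cycPowAdj k ℓ i j = (1 ≤ d) × (d ≤ ℓ)
  where d = (toℕ j + k ∸ toℕ i) % k

C62Adj : Fin 6 → Fin 6 → Set
C62Adj = cycPowAdj 6 2

ContainsC62 : ∀ {n} → OrientedGraph n → Set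
ContainsC62 {n} G =
  Σ (Fin 6 → Fin n) λ f →
    Injective _≡_ _≡_ f × (∀ i j → C62Adj i j → adj G (f i) (f j) ≡ true)

-- "d works": every oriented graph on n vertices with δ⁰ ≥ d contains C_6^2.
-- g(n, C_6^2) is the least d with this property, so g(n,C_6^2) > d
-- iff ¬ Forces n d.
Forces : ℕ → ℕ → Set
Forces n d = (G : OrientedGraph n) → MinSemiDegAtLeast G d → ContainsC62 G

{-# OPTIONS --safe #-}
-- Blow up the Paley tournament on ℤ/7 (x → y iff y − x ∈ {1, 2, 4}) into n vertices split into
-- seven independent classes by residue mod 7: every vertex has at least 3⌊n/7⌋ in- and
-- out-neighbours. A copy of C_6^2 would project to a homomorphism into the tournament. There the
-- only common out-neighbour of x and x + s is x + 2s, so the images of v₀, …, v₄ form an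
-- arithmetic progression, and the edge v₄v₀ would need −4s = 3s to be a residue, which it is not.
module Submission where

open import Defs
open import Data.Nat using (ℕ; zero; suc; _+_; _*_; _∸_; _≤_; _<_; NonZero; z≤n; s≤s; s≤s⁻¹)
open import Data.Nat.Properties
open import Data.Nat.DivMod using (_/_; _%_; _mod_; m≡m%n+[m/n]*n; m%n<n; [m+n]%n≡m%n; m<n⇒m%n≡m)
open import Data.Nat.Tactic.RingSolver using (solve-∀)
open import Data.Fin using (Fin; toℕ) renaming (_≟_ to _≟ᶠ_)
open import Data.Fin.Patterns
open import Data.Fin.Properties using (all?; fromℕ<-cong; fromℕ<-toℕ; toℕ<n)
open import Data.Bool using (Bool; true; false; if_then_else_) renaming (_≟_ to _≟ᵇ_)
open import Data.Bool.Properties using (T?)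
open import Data.List using (length; filter; tabulate; allFin)
open import Data.Product using (Σ; _,_; _×_; proj₁; proj₂)
open import Function using (_∘_)
open import Relation.Binary.PropositionalEquality
open import Relation.Nullary using (¬_; Dec)
open import Relation.Nullary.Decidable using (from-yes; _→-dec_; _×-dec_; ¬?)

count : ℕ → (ℕ → Bool) → ℕ
count zero    p = 0
count (suc n) p = (if p 0 then 1 else 0) + count n (p ∘ suc)

count-+ : ∀ a b p → count (a + b) p ≡ count a p + count b (λ i → p (a + i))
count-+ zero    b p = refl
count-+ (suc a) b p =
  trans (cong ((if p 0 then 1 else 0) +_) (count-+ a b (p ∘ suc)))
        (sym (+-assoc (if p 0 then 1 else 0) _ _))

count-cong : ∀ n {p q} → (∀ i → p i ≡ q i) → count n p ≡ count n q
count-cong zero    p≗q = refl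
count-cong (suc n) p≗q =
  cong₂ _+_ (cong (λ b → if b then 1 else 0) (p≗q 0)) (count-cong n (p≗q ∘ suc))

count-mono : ∀ {a b} p → a ≤ b → count a p ≤ count b p
count-mono p z≤n     = z≤n
count-mono p (s≤s h) = +-monoʳ-≤ (if p 0 then 1 else 0) (count-mono (p ∘ suc) h)

count-periodic : ∀ m p → (∀ i → p (m + i) ≡ p i) →
                 ∀ q → count (q * m) p ≡ q * count m p
count-periodic m p periodic zero    = refl
count-periodic m p periodic (suc q) = begin
  count (m + q * m) p                         ≡⟨ count-+ m (q * m) p ⟩
  count m p + count (q * m) (λ i → p (m + i)) ≡⟨ cong (count m p +_) (count-cong (q * m) periodic) ⟩
  count m p + count (q * m) p                 ≡⟨ cong (count m p +_) (count-periodic m p periodic q) ⟩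
  count m p + q * count m p                   ∎
  where open ≡-Reasoning

count-periodic-≥ : ∀ m .{{_ : NonZero m}} p → (∀ i → p (m + i) ≡ p i) →
                   ∀ n → n / m * count m p ≤ count n p
count-periodic-≥ m p periodic n = begin
  n / m * count m p   ≡⟨ count-periodic m p periodic (n / m) ⟨
  count (n / m * m) p ≤⟨ count-mono p n/m*m≤n ⟩
  count n p           ∎
  where
  open ≤-Reasoning
  n/m*m≤n : n / m * m ≤ n
  n/m*m≤n = subst (n / m * m ≤_) (sym (m≡m%n+[m/n]*n n m)) (m≤n+m _ (n % m))

length-filter-tabulate : ∀ {A : Set} n (f : Fin n → A) (q : A → Bool) (p : ℕ → Bool) →
  (∀ i → q (f i) ≡ p (toℕ i)) → length (filter (T? ∘ q) (tabulate f)) ≡ count n p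
length-filter-tabulate zero    f q p q≗p = refl
length-filter-tabulate (suc n) f q p q≗p with q (f 0F) | p 0 | q≗p 0F
... | true  | true  | _ = cong suc (length-filter-tabulate n (f ∘ Fin.suc) q (p ∘ suc) (q≗p ∘ Fin.suc))
... | false | false | _ = length-filter-tabulate n (f ∘ Fin.suc) q (p ∘ suc) (q≗p ∘ Fin.suc)

minSemiDeg-mono : ∀ {n} {G : OrientedGraph n} {a b} →
                  a ≤ b → MinSemiDegAtLeast G b → MinSemiDegAtLeast G a
minSemiDeg-mono a≤b δ⁰G v = ≤-trans a≤b (proj₁ (δ⁰G v)) , ≤-trans a≤b (proj₂ (δ⁰G v))

C62Hom : ∀ {m} → OrientedGraph m → Set
C62Hom {m} H = Σ (Fin 6 → Fin m) λ f → ∀ i j → C62Adj i j → adj H (f i) (f j) ≡ true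

module _ {m : ℕ} .{{_ : NonZero m}} where

  part : ∀ {n} → Fin n → Fin m
  part v = toℕ v mod m

  mod-periodic : ∀ i → (m + i) mod m ≡ i mod m
  mod-periodic i = fromℕ<-cong _ _ (trans (cong (_% m) (+-comm m i)) ([m+n]%n≡m%n i m)) _ _

  toℕ-mod : ∀ (i : Fin m) → toℕ i mod m ≡ i
  toℕ-mod i = trans (fromℕ<-cong _ _ (m<n⇒m%n≡m (toℕ<n i)) _ (toℕ<n i)) (fromℕ<-toℕ i _)

  blowUp : OrientedGraph m → (n : ℕ) → OrientedGraph n
  blowUp H n = record
    { adj      = λ u v → adj H (part u) (part v)
    ; loopless = λ v → loopless H (part v)
    ; oriented = λ u v → oriented H (part u) (part v)
    }

  length-filter-part : ∀ n (ρ : Fin m → Bool) →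
    n / m * length (filter (T? ∘ ρ) (allFin m)) ≤ length (filter (T? ∘ ρ ∘ part) (allFin n))
  length-filter-part n ρ = begin
    n / m * length (filter (T? ∘ ρ) (allFin m))
      ≡⟨ cong (n / m *_) (length-filter-tabulate m _ ρ p (cong ρ ∘ sym ∘ toℕ-mod)) ⟩
    n / m * count m p
      ≤⟨ count-periodic-≥ m p (cong ρ ∘ mod-periodic) n ⟩
    count n p
      ≡⟨ length-filter-tabulate n _ (ρ ∘ part) p (λ _ → refl) ⟨
    length (filter (T? ∘ ρ ∘ part) (allFin n)) ∎
    where
    open ≤-Reasoning
    p : ℕ → Bool
    p i = ρ (i mod m)

  blowUp-minSemiDeg : ∀ {H r} n → MinSemiDegAtLeast H r →
                      MinSemiDegAtLeast (blowUp H n) (n / m * r)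
  blowUp-minSemiDeg {H} n δ⁰H v =
      ≤-trans (*-monoʳ-≤ (n / m) (proj₁ (δ⁰H c))) (length-filter-part n (adj H c))
    , ≤-trans (*-monoʳ-≤ (n / m) (proj₂ (δ⁰H c))) (length-filter-part n (λ u → adj H u c))
    where c = part v

  blowUp-C62Hom : ∀ {H n} → ContainsC62 (blowUp H n) → C62Hom H
  blowUp-C62Hom (f , _ , hom) = part ∘ f , hom

isResidue₇ : Fin 7 → Bool
isResidue₇ 1F = true
isResidue₇ 2F = true
isResidue₇ 4F = true
isResidue₇ _  = false

_-₇_ : Fin 7 → Fin 7 → Fin 7
y -₇ x = (toℕ y + 7 ∸ toℕ x) mod 7

paley7Adj : Fin 7 → Fin 7 → Bool
paley7Adj x y = isResidue₇ (y -₇ x)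

paley7 : OrientedGraph 7
paley7 = record
  { adj      = paley7Adj
  ; loopless = from-yes (all? λ v → paley7Adj v v ≟ᵇ false)
  ; oriented = from-yes (all? λ u → all? λ v →
                 (paley7Adj u v ≟ᵇ true) →-dec (paley7Adj v u ≟ᵇ false))
  }

paley7-minSemiDeg : MinSemiDegAtLeast paley7 3
paley7-minSemiDeg = from-yes (all? λ v → (3 ≤? outdeg paley7 v) ×-dec (3 ≤? indeg paley7 v))

Edge₇ : Fin 7 → Fin 7 → Set
Edge₇ x y = paley7Adj x y ≡ true

edge₇? : ∀ x y → Dec (Edge₇ x y)
edge₇? x y = paley7Adj x y ≟ᵇ true

apex : Fin 7 → Fin 7 → Fin 7
apex x y = (2 * toℕ y + 7 ∸ toℕ x) mod 7

paley7-common-out : ∀ x y z → Edge₇ x y → Edge₇ x z → Edge₇ y z → z ≡ apex x y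
paley7-common-out = from-yes (all? λ x → all? λ y → all? λ z →
  edge₇? x y →-dec edge₇? x z →-dec edge₇? y z →-dec (z ≟ᶠ apex x y))

paley7-no-closing-edge : ∀ x y → Edge₇ x y → ¬ Edge₇ (apex (apex x y) (apex y (apex x y))) x
paley7-no-closing-edge = from-yes (all? λ x → all? λ y →
  edge₇? x y →-dec ¬? (edge₇? (apex (apex x y) (apex y (apex x y))) x))

paley7-¬C62Hom : ¬ C62Hom paley7
paley7-¬C62Hom (f , hom) =
  paley7-no-closing-edge x y (hom 0F 1F hop₁) (subst (λ w → Edge₇ w x) f₄ (hom 4F 0F hop₂))
  where
  hop₁ : 1 ≤ 1 × 1 ≤ 2
  hop₁ = s≤s z≤n , s≤s z≤n
  hop₂ : 1 ≤ 2 × 2 ≤ 2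
  hop₂ = s≤s z≤n , s≤s (s≤s z≤n)
  x y : Fin 7
  x = f 0F
  y = f 1F
  f₂ : f 2F ≡ apex x y
  f₂ = paley7-common-out x y (f 2F) (hom 0F 1F hop₁) (hom 0F 2F hop₂) (hom 1F 2F hop₁)
  f₃ : f 3F ≡ apex y (apex x y)
  f₃ = trans (paley7-common-out y (f 2F) (f 3F) (hom 1F 2F hop₁) (hom 1F 3F hop₂) (hom 2F 3F hop₁))
             (cong (apex y) f₂)
  f₄ : f 4F ≡ apex (apex x y) (apex y (apex x y))
  f₄ = trans (paley7-common-out (f 2F) (f 3F) (f 4F) (hom 2F 3F hop₁) (hom 2F 4F hop₂) (hom 3F 4F hop₁))
             (cong₂ apex f₂ f₃)

d≤3⌊n/7⌋ : ∀ k n d → 2 * k ≤ n → 7 * k * d + 7 * n < 3 * k * n → d ≤ n / 7 * 3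
d≤3⌊n/7⌋ k n d 2k≤n small = ≮⇒≥ λ 3q<d → <⇒≱ small (begin
  3 * k * n                         ≡⟨ cong (3 * k *_) (m≡m%n+[m/n]*n n 7) ⟩
  3 * k * (r + q * 7)               ≡⟨ expand k r q ⟩
  3 * k * r + 21 * k * q            ≤⟨ +-monoˡ-≤ (21 * k * q) (*-monoʳ-≤ (3 * k) r≤6) ⟩
  3 * k * 6 + 21 * k * q            ≤⟨ m≤m+n _ (3 * k) ⟩
  3 * k * 6 + 21 * k * q + 3 * k    ≡⟨ regroup k q ⟩
  7 * k * suc (q * 3) + 7 * (2 * k) ≤⟨ +-mono-≤ (*-monoʳ-≤ (7 * k) 3q<d) (*-monoʳ-≤ 7 2k≤n) ⟩
  7 * k * d + 7 * n                 ∎)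
  where
  open ≤-Reasoning
  q r : ℕ
  q = n / 7
  r = n % 7
  r≤6 : r ≤ 6
  r≤6 = s≤s⁻¹ (m%n<n n 7)
  expand : ∀ k r q → 3 * k * (r + q * 7) ≡ 3 * k * r + 21 * k * q
  expand = solve-∀
  regroup : ∀ k q → 3 * k * 6 + 21 * k * q + 3 * k ≡ 7 * k * suc (q * 3) + 7 * (2 * k)
  regroup = solve-∀

proposition1p12 : (k : ℕ) → 1 ≤ k →
    Σ ℕ λ N → (n : ℕ) → N ≤ n → (d : ℕ) →
      7 * k * d + 7 * n < 3 * k * n → ¬ Forces n d
proposition1p12 k _ = 2 * k , λ n 2k≤n d small forces →
  let G = blowUp paley7 n
      δ⁰G≥d = minSemiDeg-mono {G = G} (d≤3⌊n/7⌋ k n d 2k≤n small)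
                                      (blowUp-minSemiDeg {H = paley7} n paley7-minSemiDeg)
  in paley7-¬C62Hom (blowUp-C62Hom {H = paley7} (forces G δ⁰G≥d))
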